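{- Let $G$ be a connected graph formed as the edge-disjoint union of a forest $F$ and another graph $R$. Then every (simple) path in $G$ is uniquely determined by its pair of endpoints together with the intersection of its edge set with the edge set of $R$. -}

module Defs where

open import Data.Nat using (ℕ; _≤_)
open import Data.Fin using (Fin)
open import Data.List using (List; []; _∷_; head; last; length)
open import Data.List.Relation.Unary.Linked using (Linked)
open import Data.List.Relation.Unary.Unique.Propositional using (Unique)
open import Data.Maybe using (just)
open import Data.Product using (_×_; ∃; ∃-syntax)
open import Data.Sum using (_⊎_)
open import Data.Empty using (⊥)
open import Relation.Nullary using (¬_)
open import Relation.Binary.PropositionalEquality using (_≡_)

record Graph (n : ℕ) : Set₁ where
  field
    Adj    : Fin n → Fin n → Set
    sym    : ∀ {x y} → Adj x y → Adj y x
    irrefl : ∀ x → ¬ Adj x x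
open Graph public

_∪_ : ∀ {n} → Graph n → Graph n → Graph n
F ∪ R = record
  { Adj    = λ x y → Adj F x y ⊎ Adj R x y
  ; sym    = λ { (Data.Sum.inj₁ a) → Data.Sum.inj₁ (sym F a)
               ; (Data.Sum.inj₂ b) → Data.Sum.inj₂ (sym R b) }
  ; irrefl = λ x → λ { (Data.Sum.inj₁ a) → irrefl F x a
                     ; (Data.Sum.inj₂ b) → irrefl R x b }
  }

EdgeDisjoint : ∀ {n} → Graph n → Graph n → Set
EdgeDisjoint F R = ∀ x y → Adj F x y → Adj R x y → ⊥

IsWalk : ∀ {n} → Graph n → Fin n → Fin n → List (Fin n) → Set
IsWalk G u v xs = Linked (Adj G) xs × head xs ≡ just u × last xs ≡ just v

IsPath : ∀ {n} → Graph n → Fin n → Fin n → List (Fin n) → Set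
IsPath G u v xs = IsWalk G u v xs × Unique xs

Connected : ∀ {n} → Graph n → Set
Connected G = ∀ u v → ∃[ xs ] IsWalk G u v xs

IsCycle : ∀ {n} → Graph n → List (Fin n) → Set
IsCycle G xs = 3 ≤ length xs × (∃[ u ] ∃[ v ] (IsPath G u v xs × Adj G v u))

IsForest : ∀ {n} → Graph n → Set
IsForest G = ∀ xs → ¬ IsCycle G xs

data Consec {n} (x y : Fin n) : List (Fin n) → Set where
  here  : ∀ {zs} → Consec x y (x ∷ y ∷ zs)
  there : ∀ {z zs} → Consec x y zs → Consec x y (z ∷ zs)

UsesEdge : ∀ {n} → List (Fin n) → Fin n → Fin n → Set
UsesEdge xs x y = Consec x y xs ⊎ Consec y x xs

module Submission where

-- Let xs, ys be simple u–v paths traversing the same R-edges.  Every edge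
-- traversed by exactly one of them (an edge of their symmetric difference)
-- is then an edge of F.  Locally, a simple u–v path traverses exactly one
-- edge at an end vertex and none or two at any other vertex; comparing the
-- two paths vertex by vertex shows that the symmetric difference has no dead
-- ends: every edge wp in it is followed by another edge wq in it, q ≢ p.  A
-- forest contains no nonempty set of edges without dead ends, since following
-- such edges without backtracking produces ever longer simple paths until a
-- cycle closes.  So every edge of xs is an edge of ys, and a simple path all
-- of whose edges lie on another simple path with the same ends equals it.

open import Defs
open import Data.Nat using (ℕ; zero; suc; _+_; _<_; _≤_; s≤s; z≤n)
open import Data.Nat.Properties using (+-suc; ≤⇒≯; m<m+n)
open import Data.Fin using (Fin; zero; suc)
open import Data.Fin.Properties using (_≟_; injective⇒≤)
open import Data.List using (List; []; _∷_; head; last; length; lookup)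
open import Data.List.Relation.Unary.Linked using (Linked; []; [-]; _∷_)
open import Data.List.Relation.Unary.All as All using (All; []; _∷_)
open import Data.List.Relation.Unary.All.Properties using (All¬⇒¬Any; ¬Any⇒All¬)
open import Data.List.Relation.Unary.AllPairs using (AllPairs; []; _∷_)
open import Data.List.Relation.Unary.Any using (here; there; any?)
open import Data.List.Membership.Propositional using (_∈_; _∉_)
open import Data.List.Membership.Propositional.Properties using (∈-lookup)
open import Data.List.Relation.Unary.Unique.Propositional using (Unique)
open import Data.Maybe using (just)
open import Data.Maybe.Properties using (just-injective)
open import Data.Product using (_×_; _,_; ∃-syntax; proj₁; proj₂; map₂)
open import Data.Sum using (_⊎_; inj₁; inj₂; swap; [_,_]′)
import Data.Sum as Sum
open import Data.Empty using (⊥; ⊥-elim)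
open import Function using (_∘_)
open import Relation.Nullary using (¬_; Dec; yes; no)
open import Relation.Nullary.Decidable using (_⊎-dec_; decidable-stable)
open import Relation.Binary.PropositionalEquality
  using (_≡_; _≢_; refl; cong; subst) renaming (sym to ≡-sym; trans to ≡-trans)

variable
  n : ℕ
  a b c p p' q u v w x x' y y' : Fin n
  xs ys zs ws : List (Fin n)

consec-∈ˡ : Consec x y zs → x ∈ zs
consec-∈ˡ here      = here refl
consec-∈ˡ (there c) = there (consec-∈ˡ c)

consec-∈-tail : Consec x y (w ∷ zs) → y ∈ zs
consec-∈-tail here                    = here refl
consec-∈-tail (there {zs = []} ())
consec-∈-tail (there {zs = _ ∷ _} c) = there (consec-∈-tail c)

consec-∈ʳ : Consec x y zs → y ∈ zs
consec-∈ʳ {zs = _ ∷ _} c = there (consec-∈-tail c)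

successor-unique : Unique zs → Consec x y zs → Consec x y' zs → y ≡ y'
successor-unique _         here      here       = refl
successor-unique (x∉ ∷ _)  here      (there c') = ⊥-elim (All¬⇒¬Any x∉ (consec-∈ˡ c'))
successor-unique (x∉ ∷ _)  (there c) here       = ⊥-elim (All¬⇒¬Any x∉ (consec-∈ˡ c))
successor-unique (_ ∷ un)  (there c) (there c') = successor-unique un c c'

predecessor-unique : Unique zs → Consec x y zs → Consec x' y zs → x ≡ x'
predecessor-unique _                 here      here       = refl
predecessor-unique (_ ∷ (y∉ ∷ _))  here      (there c') = ⊥-elim (All¬⇒¬Any y∉ (consec-∈-tail c'))
predecessor-unique (_ ∷ (y∉ ∷ _))  (there c) here       = ⊥-elim (All¬⇒¬Any y∉ (consec-∈-tail c))
predecessor-unique (_ ∷ un)         (there c) (there c') = predecessor-unique un c c'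

consec-asym : Unique zs → Consec x y zs → Consec y x zs → ⊥
consec-asym ((x≢y ∷ _) ∷ _) here      here       = x≢y refl
consec-asym (x∉ ∷ _)         here      (there c') = All¬⇒¬Any x∉ (there (consec-∈-tail c'))
consec-asym (y∉ ∷ _)         (there c) here       = All¬⇒¬Any y∉ (there (consec-∈-tail c))
consec-asym (_ ∷ un)         (there c) (there c') = consec-asym un c c'

head-no-predecessor : Unique (u ∷ zs) → ¬ Consec p u (u ∷ zs)
head-no-predecessor ((u≢u ∷ _) ∷ _) here      = u≢u refl
head-no-predecessor (u∉ ∷ _)         (there c) = All¬⇒¬Any u∉ (consec-∈ʳ c)

last-∈ : last zs ≡ just v → v ∈ zs
last-∈ {zs = _ ∷ []}     eq = here (≡-sym (just-injective eq))
last-∈ {zs = _ ∷ y ∷ zs} eq = there (last-∈ {zs = y ∷ zs} eq)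

last-no-successor : Unique zs → last zs ≡ just v → ¬ Consec v p zs
last-no-successor (v∉ ∷ _) eq here                   = All¬⇒¬Any v∉ (last-∈ eq)
last-no-successor _        eq (there {zs = []} ())
last-no-successor (_ ∷ un) eq (there {zs = _ ∷ _} c) = last-no-successor un eq c

has-predecessor : x ∈ (w ∷ zs) → x ≢ w → ∃[ p ] Consec p x (w ∷ zs)
has-predecessor (here x≡w) x≢w = ⊥-elim (x≢w x≡w)
has-predecessor (there m)  _   = go m
  where
  go : x ∈ zs → ∃[ p ] Consec p x (w ∷ zs)
  go (here refl) = _ , here
  go (there m)   = map₂ there (go m)

has-successor : x ∈ zs → last zs ≡ just v → x ≢ v → ∃[ s ] Consec x s zs
has-successor {zs = _ ∷ []}    (here refl) eq x≢v = ⊥-elim (x≢v (just-injective eq))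
has-successor {zs = _ ∷ _ ∷ _} (here refl) _  _   = _ , here
has-successor {zs = _ ∷ _ ∷ _} (there m)   eq x≢v = map₂ there (has-successor m eq x≢v)

consec? : (x y : Fin n) (zs : List (Fin n)) → Dec (Consec x y zs)
consec? x y []             = no λ ()
consec? x y (z ∷ [])       = no λ { (there ()) }
consec? x y (z ∷ z' ∷ zs) with x ≟ z | y ≟ z' | consec? x y (z' ∷ zs)
... | yes refl | yes refl | _     = yes here
... | _        | _        | yes c = yes (there c)
... | no x≢z   | _        | no ¬c = no λ { here → x≢z refl ; (there c) → ¬c c }
... | yes _    | no y≢z'  | no ¬c = no λ { here → y≢z' refl ; (there c) → ¬c c }

uses? : (zs : List (Fin n)) (x y : Fin n) → Dec (UsesEdge zs x y)
uses? zs x y = consec? x y zs ⊎-dec consec? y x zs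

uses-sym : UsesEdge zs a b → UsesEdge zs b a
uses-sym = swap

uses-∈ : UsesEdge zs a b → a ∈ zs
uses-∈ (inj₁ c) = consec-∈ˡ c
uses-∈ (inj₂ c) = consec-∈ʳ c

uses-there : UsesEdge zs a b → UsesEdge (x ∷ zs) a b
uses-there = Sum.map there there

uses-adj : (G : Graph n) → Linked (Adj G) zs → UsesEdge zs a b → Adj G a b
uses-adj G L (inj₁ c) = linked-consec L c
  where
  linked-consec : Linked (Adj G) zs → Consec a b zs → Adj G a b
  linked-consec (r ∷ _) here      = r
  linked-consec (_ ∷ L) (there c) = linked-consec L c
uses-adj G L (inj₂ c) = sym G (uses-adj G L (inj₁ c))

at-most-two-edges : Unique zs → UsesEdge zs w p → UsesEdge zs w p' → p ≢ p'
                  → UsesEdge zs w q → q ≡ p ⊎ q ≡ p'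
at-most-two-edges un (inj₁ c) (inj₁ c') p≢p' _ = ⊥-elim (p≢p' (successor-unique un c c'))
at-most-two-edges un (inj₂ c) (inj₂ c') p≢p' _ = ⊥-elim (p≢p' (predecessor-unique un c c'))
at-most-two-edges un (inj₁ c) (inj₂ c') _ (inj₁ d) = inj₁ (successor-unique un d c)
at-most-two-edges un (inj₁ c) (inj₂ c') _ (inj₂ d) = inj₂ (predecessor-unique un d c')
at-most-two-edges un (inj₂ c) (inj₁ c') _ (inj₁ d) = inj₂ (successor-unique un d c')
at-most-two-edges un (inj₂ c) (inj₁ c') _ (inj₂ d) = inj₁ (predecessor-unique un d c)

head-edge-unique : Unique (u ∷ zs) → UsesEdge (u ∷ zs) u p → UsesEdge (u ∷ zs) u p' → p ≡ p'
head-edge-unique un (inj₁ c) (inj₁ c') = successor-unique un c c'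
head-edge-unique un (inj₂ c) _         = ⊥-elim (head-no-predecessor un c)
head-edge-unique un _        (inj₂ c') = ⊥-elim (head-no-predecessor un c')

last-edge-unique : Unique zs → last zs ≡ just v → UsesEdge zs v p → UsesEdge zs v p' → p ≡ p'
last-edge-unique un eq (inj₂ c) (inj₂ c') = predecessor-unique un c c'
last-edge-unique un eq (inj₁ c) _         = ⊥-elim (last-no-successor un eq c)
last-edge-unique un eq _        (inj₁ c') = ⊥-elim (last-no-successor un eq c')

-- A duplicate-free vertex sequence from u to v: a simple path with the
-- adjacency of consecutive vertices forgotten.
record Route {n} (u v : Fin n) (zs : List (Fin n)) : Set where
  constructor route
  field
    unique : Unique zs
    starts : head zs ≡ just u
    ends   : last zs ≡ just v

IsEnd : Fin n → Fin n → Fin n → Set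
IsEnd u v w = w ≡ u ⊎ w ≡ v

ends-distinct : Route u v zs → UsesEdge zs a b → u ≢ v
ends-distinct {zs = _ ∷ []}    _                           (inj₁ (there ()))
ends-distinct {zs = _ ∷ []}    _                           (inj₂ (there ()))
ends-distinct {zs = _ ∷ _ ∷ _} (route (u∉ ∷ _) refl eq) _ refl = All¬⇒¬Any u∉ (last-∈ eq)

end-edge-unique : Route u v zs → IsEnd u v w → UsesEdge zs w p → UsesEdge zs w p' → p ≡ p'
end-edge-unique {zs = _ ∷ _} (route un refl _) (inj₁ refl) = head-edge-unique un
end-edge-unique (route un _ eq) (inj₂ refl) = last-edge-unique un eq

end-has-edge : Route u v zs → u ≢ v → IsEnd u v w → ∃[ q ] UsesEdge zs w q
end-has-edge {zs = _ ∷ []}    (route _ refl eq) u≢v _           = ⊥-elim (u≢v (just-injective eq))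
end-has-edge {zs = _ ∷ y ∷ _} (route _ refl _)  _   (inj₁ refl) = y , inj₁ here
end-has-edge {zs = _ ∷ _}     (route _ refl eq) u≢v (inj₂ refl) =
  map₂ inj₂ (has-predecessor (last-∈ eq) (u≢v ∘ ≡-sym))

inner-second-edge : Route u v zs → ¬ IsEnd u v w → UsesEdge zs w p
                  → ∃[ p' ] (p' ≢ p × UsesEdge zs w p')
inner-second-edge {zs = _ ∷ _} (route un refl _) inner (inj₁ c)
  with p' , c' ← has-predecessor (consec-∈ˡ c) (inner ∘ inj₁)
  = p' , (λ { refl → consec-asym un c c' }) , inj₂ c'
inner-second-edge (route un _ eq) inner (inj₂ c)
  with s , c' ← has-successor (consec-∈ʳ c) eq (inner ∘ inj₂)
  = s , (λ { refl → consec-asym un c c' }) , inj₁ c'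

OnlyIn : List (Fin n) → List (Fin n) → Fin n → Fin n → Set
OnlyIn xs ys a b = UsesEdge xs a b × ¬ UsesEdge ys a b

SymDiff : List (Fin n) → List (Fin n) → Fin n → Fin n → Set
SymDiff xs ys a b = OnlyIn xs ys a b ⊎ OnlyIn ys xs a b

symDiff-sym : SymDiff xs ys a b → SymDiff xs ys b a
symDiff-sym = Sum.map flip flip
  where
  flip : OnlyIn xs ys a b → OnlyIn xs ys b a
  flip (e , ¬f) = uses-sym e , ¬f ∘ uses-sym

-- At an end vertex w, ys traverses an edge wq; q ≢ p as ys misses wp, and xs
-- misses wq as its only edge at w is wp.
onlyIn-extends-at-end : Route u v xs → Route u v ys → IsEnd u v w → OnlyIn xs ys w p
                      → ∃[ q ] (q ≢ p × OnlyIn ys xs w q)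
onlyIn-extends-at-end {ys = ys} {w = w} rx ry end (e , ¬f)
  with q , f ← end-has-edge ry (ends-distinct rx e) end
  = q , (λ { refl → ¬f f }) , f , λ e' → ¬f (subst (UsesEdge ys w) (end-edge-unique rx end e' e) f)

-- At an inner vertex w, xs traverses a second edge wp'.  Either ys misses
-- it, or ys traverses a second edge wq besides wp', which xs misses since
-- its only edges at w are wp and wp'.
onlyIn-extends-inside : Route u v xs → Route u v ys → ¬ IsEnd u v w → OnlyIn xs ys w p
                      → ∃[ q ] (q ≢ p × SymDiff xs ys w q)
onlyIn-extends-inside {ys = ys} {w = w} rx ry inner (e , ¬f)
  with p' , p'≢p , e' ← inner-second-edge rx inner e
  with uses? ys w p'
... | no ¬f' = p' , p'≢p , inj₁ (e' , ¬f')
... | yes f'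
  with q , q≢p' , f ← inner-second-edge ry inner f'
  = q , q≢p , inj₂ (f , [ q≢p , q≢p' ]′ ∘ at-most-two-edges (Route.unique rx) e e' (p'≢p ∘ ≡-sym))
  where
  q≢p : q ≢ _
  q≢p refl = ¬f f

onlyIn-extends : Route u v xs → Route u v ys → OnlyIn xs ys w p
               → ∃[ q ] (q ≢ p × SymDiff xs ys w q)
onlyIn-extends {u = u} {v = v} {w = w} rx ry o with (w ≟ u) ⊎-dec (w ≟ v)
... | yes end  = map₂ (map₂ inj₂) (onlyIn-extends-at-end rx ry end o)
... | no inner = onlyIn-extends-inside rx ry inner o

symDiff-extends : Route u v xs → Route u v ys → SymDiff xs ys w p
                → ∃[ q ] (q ≢ p × SymDiff xs ys w q)
symDiff-extends rx ry (inj₁ o) = onlyIn-extends rx ry o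
symDiff-extends rx ry (inj₂ o) = map₂ (map₂ swap) (onlyIn-extends ry rx o)

prefix : {A : Set} {x : A} {xs : List A} → x ∈ xs → List A
prefix {xs = y ∷ _} (here _)  = y ∷ []
prefix {xs = y ∷ _} (there m) = y ∷ prefix m

module _ {A : Set} {x : A} where

  prefix-nonempty : {xs : List A} (m : x ∈ xs) → 1 ≤ length (prefix m)
  prefix-nonempty (here _)  = s≤s z≤n
  prefix-nonempty (there _) = s≤s z≤n

  last-prefix : (a : A) {xs : List A} (m : x ∈ xs) → last (a ∷ prefix m) ≡ just x
  last-prefix a         (here refl) = refl
  last-prefix a {y ∷ _} (there m)   = last-prefix y m

  All-prefix : {P : A → Set} {xs : List A} → All P xs → (m : x ∈ xs) → All P (prefix m)
  All-prefix (px ∷ _)  (here _)  = px ∷ []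
  All-prefix (px ∷ ps) (there m) = px ∷ All-prefix ps m

  AllPairs-prefix : {R : A → A → Set} {xs : List A} → AllPairs R xs → (m : x ∈ xs)
                  → AllPairs R (prefix m)
  AllPairs-prefix (_ ∷ _)    (here _)  = [] ∷ []
  AllPairs-prefix (rs ∷ rss) (there m) = All-prefix rs m ∷ AllPairs-prefix rss m

  Linked-prefix : {R : A → A → Set} {a : A} {xs : List A} → Linked R (a ∷ xs) → (m : x ∈ xs)
                → Linked R (a ∷ prefix m)
  Linked-prefix (r ∷ _) (here _)  = r ∷ [-]
  Linked-prefix (r ∷ L) (there m) = r ∷ Linked-prefix L m

lookup-injective : {A : Set} {xs : List A} → Unique xs → ∀ {i j} → lookup xs i ≡ lookup xs j → i ≡ j
lookup-injective {xs = []} _ {()}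
lookup-injective {xs = _ ∷ _} _        {zero}  {zero}  _  = refl
lookup-injective {xs = _ ∷ _} (x∉ ∷ _) {zero}  {suc j} eq = ⊥-elim (All.lookup x∉ (∈-lookup j) eq)
lookup-injective {xs = _ ∷ _} (x∉ ∷ _) {suc i} {zero}  eq = ⊥-elim (All.lookup x∉ (∈-lookup i) (≡-sym eq))
lookup-injective {xs = _ ∷ _} (_ ∷ un) {suc i} {suc j} eq = cong suc (lookup-injective un eq)

unique-length : {zs : List (Fin n)} → Unique zs → length zs ≤ n
unique-length un = injective⇒≤ (lookup-injective un)

closes-cycle : (F : Graph n) → Linked (Adj F) (c ∷ p ∷ zs) → Unique (c ∷ p ∷ zs)
             → (m : q ∈ zs) → Adj F q c → IsCycle F (c ∷ p ∷ prefix m)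
closes-cycle {c = c} {p = p} F (cp ∷ L) ((c≢p ∷ c∉) ∷ p∉ ∷ un) m qc =
  s≤s (s≤s (prefix-nonempty m)) , c , _ ,
  ((cp ∷ Linked-prefix L m , refl , last-prefix p m) ,
   (c≢p ∷ All-prefix c∉ m) ∷ All-prefix p∉ m ∷ AllPairs-prefix un m) ,
  qc

module _ {n} {F : Graph n} (forest : IsForest F) {D : Fin n → Fin n → Set}
         (D⊆F : ∀ {a b} → D a b → Adj F a b)
         (D-sym : ∀ {a b} → D a b → D b a)
         (D-extends : ∀ {w p} → D w p → ∃[ q ] (q ≢ p × D w q)) where

  -- A simple path c p … in F starting with a D-edge can be prolonged at c
  -- along D by a new vertex; k bounds how often this can still happen.
  prolong : {c p : Fin n} {zs : List (Fin n)} (k : ℕ) → n < k + length (c ∷ p ∷ zs)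
          → Unique (c ∷ p ∷ zs) → Linked (Adj F) (c ∷ p ∷ zs) → D c p → ⊥
  prolong zero n<l un _ _ = ≤⇒≯ (unique-length un) n<l
  prolong {c = c} {p = p} {zs = zs} (suc k) n<l un L dcp
    with q , q≢p , dcq ← D-extends dcp
    with any? (q ≟_) (c ∷ p ∷ zs)
  ... | no q∉ = prolong k (subst (n <_) (≡-sym (+-suc k _)) n<l)
                          (¬Any⇒All¬ _ q∉ ∷ un) (sym F (D⊆F dcq) ∷ L) (D-sym dcq)
  ... | yes (here refl)         = irrefl F c (D⊆F dcq)
  ... | yes (there (here refl)) = q≢p refl
  ... | yes (there (there m))   = forest _ (closes-cycle F L un m (sym F (D⊆F dcq)))

  -- Any D-edge ab yields the initial path b a, with room for n extensions.
  dead-end-free-empty : ∀ {a b} → ¬ D a b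
  dead-end-free-empty {a} {b} dab =
    prolong n (m<m+n n (s≤s z≤n)) (((λ { refl → irrefl F a (D⊆F dab) }) ∷ []) ∷ [] ∷ [])
            (sym F (D⊆F dab) ∷ [-]) (D-sym dab)

drop-head-edge : x ∉ zs → UsesEdge zs a b → UsesEdge (x ∷ ws) a b → UsesEdge ws a b
drop-head-edge x∉ e (inj₁ here)      = ⊥-elim (x∉ (uses-∈ e))
drop-head-edge x∉ e (inj₁ (there c)) = inj₁ c
drop-head-edge x∉ e (inj₂ here)      = ⊥-elim (x∉ (uses-∈ (uses-sym e)))
drop-head-edge x∉ e (inj₂ (there c)) = inj₂ c

-- Induction along xs: both lists start at x, and the edge of xs at x is an
-- edge of ys at its first vertex, hence their second vertices agree.
route-determined : Unique xs → Unique ys → head xs ≡ head ys → last xs ≡ last ys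
                 → (∀ {a b} → UsesEdge xs a b → UsesEdge ys a b) → xs ≡ ys
route-determined {xs = []}    {ys = []}    _ _ _ _ _ = refl
route-determined {xs = _ ∷ _} {ys = []}    _ _ () _ _
route-determined {xs = []}    {ys = _ ∷ _} _ _ () _ _
route-determined {xs = _ ∷ []}    {ys = _ ∷ []}    _ _ refl _ _ = refl
route-determined {xs = _ ∷ []}    {ys = _ ∷ _ ∷ _} _ (x∉ ∷ _) refl eq _ =
  ⊥-elim (All¬⇒¬Any x∉ (last-∈ (≡-sym eq)))
route-determined {xs = _ ∷ _ ∷ _} {ys = _ ∷ []}    (x∉ ∷ _) _ refl eq _ =
  ⊥-elim (All¬⇒¬Any x∉ (last-∈ eq))
route-determined {xs = x ∷ _ ∷ _} {ys = _ ∷ _ ∷ _} (x∉ ∷ ux) uy@(_ ∷ uy') refl eq sub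
  with refl ← head-edge-unique uy (inj₁ here) (sub (inj₁ here))
  = cong (x ∷_) (route-determined ux uy' refl eq
      (λ e → drop-head-edge (All¬⇒¬Any x∉) e (sub (uses-there e))))

union-left : (F R : Graph n) → Adj (F ∪ R) a b → ¬ Adj R a b → Adj F a b
union-left F R (inj₁ f) _  = f
union-left F R (inj₂ r) ¬r = ⊥-elim (¬r r)

lemma6 : (n : ℕ) (F R : Graph n) → IsForest F → EdgeDisjoint F R → Connected (F ∪ R)
         → (u v : Fin n) (xs ys : List (Fin n))
         → IsPath (F ∪ R) u v xs → IsPath (F ∪ R) u v ys
         → (∀ x y → Adj R x y → (UsesEdge xs x y → UsesEdge ys x y) × (UsesEdge ys x y → UsesEdge xs x y))
         → xs ≡ ys
lemma6 n F R forest _ _ u v xs ys ((Lx , sx , ex) , ux) ((Ly , sy , ey) , uy) sameR =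
  route-determined ux uy (≡-trans sx (≡-sym sy)) (≡-trans ex (≡-sym ey)) traversed-by-ys
  where
  -- Edges traversed by just one of the paths are not R-edges, hence F-edges.
  symDiff⊆F : ∀ {a b} → SymDiff xs ys a b → Adj F a b
  symDiff⊆F (inj₁ (e , ¬f)) = union-left F R (uses-adj (F ∪ R) Lx e) (λ r → ¬f (proj₁ (sameR _ _ r) e))
  symDiff⊆F (inj₂ (f , ¬e)) = union-left F R (uses-adj (F ∪ R) Ly f) (λ r → ¬e (proj₂ (sameR _ _ r) f))

  -- Being edges of a forest without dead ends, there are none.
  traversed-by-ys : ∀ {a b} → UsesEdge xs a b → UsesEdge ys a b
  traversed-by-ys {a} {b} e = decidable-stable (uses? ys a b) λ ¬f →
    dead-end-free-empty {F = F} forest symDiff⊆F symDiff-sym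
      (symDiff-extends (route ux sx ex) (route uy sy ey)) (inj₁ (e , ¬f))
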